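{- Let $G$ be a standard graph and $\overline G$ its transitive closure (same nodes and labels, with an edge $(a,b)$ whenever $a\neq b$ and $b$ is reachable from $a$ by a directed path in $G$). Then the standard decompositions of $G$ and of $\overline G$ are in canonical bijection.
   Context: A labeled graph: finite node set, loopless directed edges, integer labeling $\ell$. It is standard if labels are $\ge0$ and $\ell(a)\le\ell(b)$ for each edge $(a,b)$. For graphs with the same nodes and edges, $\oplus,\ominus$ add/subtract labels nodewise. A standard component of $G$ is a labeled graph $H$ with the same nodes and edges as $G$, labels in $\{0,1\}$, $H$ and $G\ominus H$ standard, not all labels zero. A standard decomposition of $G$ is a finite multiset of standard components summing to $G$. -}

module Defs where

open import Level using (0ℓ)
open import Data.Nat using (ℕ)
open import Data.Fin using (Fin)
open import Data.Integer using (ℤ; _+_; _-_; _≤_; 0ℤ; 1ℤ)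
open import Data.List using (List; foldr)
open import Data.List.Relation.Unary.All using (All)
open import Data.Product using (Σ; _×_)
open import Data.Sum using (_⊎_)
open import Relation.Nullary using (¬_)
open import Relation.Binary.PropositionalEquality using (_≡_; _≢_)
open import Relation.Binary.Construct.Closure.Transitive using (TransClosure)

record LabeledGraph : Set₁ where
  field
    n        : ℕ
    Edge     : Fin n → Fin n → Set
    loopless : ∀ a → ¬ Edge a a
    label    : Fin n → ℤ
open LabeledGraph public

Labeling : ℕ → Set
Labeling n = Fin n → ℤ

IsStandardLabeling : ∀ {n} → (Fin n → Fin n → Set) → Labeling n → Set
IsStandardLabeling E ℓ = (∀ a → 0ℤ ≤ ℓ a) × (∀ a b → E a b → ℓ a ≤ ℓ b)

IsStandard : LabeledGraph → Set
IsStandard G = IsStandardLabeling (Edge G) (label G)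

_⊕_ : ∀ {n} → Labeling n → Labeling n → Labeling n
(f ⊕ g) a = f a + g a

_⊖_ : ∀ {n} → Labeling n → Labeling n → Labeling n
(f ⊖ g) a = f a - g a

zeroLabeling : ∀ {n} → Labeling n
zeroLabeling _ = 0ℤ

-- A standard component of G is a labeled graph H with the same nodes and
-- edges as G; it is therefore determined by its labeling h.
IsStandardComponent : (G : LabeledGraph) → Labeling (n G) → Set
IsStandardComponent G h =
  (∀ a → (h a ≡ 0ℤ) ⊎ (h a ≡ 1ℤ))
  × IsStandardLabeling (Edge G) h
  × IsStandardLabeling (Edge G) (label G ⊖ h)
  × ¬ (∀ a → h a ≡ 0ℤ)

sumLabelings : ∀ {n} → List (Labeling n) → Labeling n
sumLabelings = foldr _⊕_ zeroLabeling

-- A standard decomposition: a finite multiset (represented by a list) of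
-- standard components whose nodewise sum is G.
IsStandardDecomposition : (G : LabeledGraph) → List (Labeling (n G)) → Set
IsStandardDecomposition G hs =
  All (IsStandardComponent G) hs × (∀ a → sumLabelings hs a ≡ label G a)

transitiveClosure : LabeledGraph → LabeledGraph
transitiveClosure G = record
  { n        = n G
  ; Edge     = λ a b → (a ≢ b) × TransClosure (Edge G) a b
  ; loopless = λ a e → Data.Product.proj₁ e _≡_.refl
  ; label    = label G
  }
  where import Data.Product

module Submission where

-- Idea: passing to the transitive closure changes neither the nodes nor the
-- labels, only the edges, and the only place edges enter the definitions is
-- the monotonicity condition "ℓ a ≤ ℓ b along every edge (a , b)" of a
-- standard labeling.  A labeling is monotone along the edges of G iff it is
-- monotone along all nonempty directed paths of G (induction on the path,
-- using transitivity of ≤), and closure edges are exactly such paths between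
-- distinct nodes; conversely every edge of the loopless graph G is itself a
-- closure edge.  Hence a labeling is standard for G iff it is standard for
-- the closure, so the same holds for standard components (which are defined
-- by standardness of h and of label G ⊖ h), and consequently a list of
-- labelings is a standard decomposition of G iff it is one of the closure:
-- the canonical bijection is the identity.

open import Defs
open import Data.Fin using (Fin)
open import Data.Integer using (_≤_)
open import Data.Integer.Properties using (≤-trans)
open import Data.List using (List)
open import Data.List.Relation.Unary.All using () renaming (map to All-map)
open import Data.Product using (_×_; _,_)
open import Function.Bundles using (_⇔_; mk⇔; module Equivalence)
open import Level using (0ℓ)
open import Relation.Binary.Core using (Rel)
open import Relation.Binary.Definitions using (Transitive)
open import Relation.Binary.Construct.Closure.Transitive using (TransClosure; [_]; _∷_)
open import Relation.Binary.PropositionalEquality using (_≢_; refl)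
open import Relation.Nullary using (¬_)

open Equivalence using (to; from)

monotone-along-paths : ∀ {a b ℓ₁ ℓ₂} {A : Set a} {B : Set b}
  {E : Rel A ℓ₁} (_≤_ : Rel B ℓ₂) → Transitive _≤_ →
  (f : A → B) → (∀ x y → E x y → f x ≤ f y) →
  ∀ {x y} → TransClosure E x y → f x ≤ f y
monotone-along-paths _≤_ trans f mono [ e ] = mono _ _ e
monotone-along-paths _≤_ trans f mono {x} (_∷_ {y = next} e path) =
  trans (mono x next e) (monotone-along-paths _≤_ trans f mono path)

ClosureEdge : ∀ {n} → Rel (Fin n) 0ℓ → Rel (Fin n) 0ℓ
ClosureEdge E a b = (a ≢ b) × TransClosure E a b

standardLabeling⇔closure : ∀ {n} (E : Rel (Fin n) 0ℓ) → (∀ a → ¬ E a a) →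
  (ℓ : Labeling n) →
  IsStandardLabeling E ℓ ⇔ IsStandardLabeling (ClosureEdge E) ℓ
standardLabeling⇔closure E loopless ℓ = mk⇔ toClosure fromClosure
  where
  toClosure : IsStandardLabeling E ℓ → IsStandardLabeling (ClosureEdge E) ℓ
  toClosure (nonneg , mono) =
    nonneg , λ a b (_ , path) → monotone-along-paths _≤_ ≤-trans ℓ mono path

  edge⇒closureEdge : ∀ {a b} → E a b → ClosureEdge E a b
  edge⇒closureEdge {a} e = (λ { refl → loopless a e }) , [ e ]

  fromClosure : IsStandardLabeling (ClosureEdge E) ℓ → IsStandardLabeling E ℓ
  fromClosure (nonneg , mono) = nonneg , λ a b e → mono a b (edge⇒closureEdge e)

standardComponent⇔closure : (G : LabeledGraph) (h : Labeling (n G)) →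
  IsStandardComponent G h ⇔ IsStandardComponent (transitiveClosure G) h
standardComponent⇔closure G h = mk⇔
  (λ (zeroOne , std-h , std-rest , nonzero) →
     zeroOne , to (transfer h) std-h , to (transfer rest) std-rest , nonzero)
  (λ (zeroOne , std-h , std-rest , nonzero) →
     zeroOne , from (transfer h) std-h , from (transfer rest) std-rest , nonzero)
  where
  transfer : (ℓ : Labeling (n G)) →
    IsStandardLabeling (Edge G) ℓ ⇔ IsStandardLabeling (ClosureEdge (Edge G)) ℓ
  transfer = standardLabeling⇔closure (Edge G) (loopless G)

  rest : Labeling (n G)
  rest = label G ⊖ h

lemma8p3 : (G : LabeledGraph) → IsStandard G →
    (hs : List (Labeling (n G))) →
    (IsStandardDecomposition G hs → IsStandardDecomposition (transitiveClosure G) hs)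
    × (IsStandardDecomposition (transitiveClosure G) hs → IsStandardDecomposition G hs)
lemma8p3 G _ hs =
  (λ (components , sums) → All-map (to (component⇔ _)) components , sums) ,
  (λ (components , sums) → All-map (from (component⇔ _)) components , sums)
  where
  component⇔ : (h : Labeling (n G)) →
    IsStandardComponent G h ⇔ IsStandardComponent (transitiveClosure G) h
  component⇔ = standardComponent⇔closure G
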